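{- If $G$ is a geodetic graph, then $\mu_{\rm t}(G)=s(G)$, and $S(G)$ is the unique total mutual-visibility set of $G$ of cardinality $\mu_{\rm t}(G)$.
   Context: A connected graph is geodetic if between any two vertices there is a unique shortest path. A vertex $v$ is simplicial if its neighbourhood $N_G(v)$ induces a complete subgraph; $S(G)$ is the set of simplicial vertices and $s(G)=|S(G)|$. For $X\subseteq V(G)$, two vertices $x,y$ are $X$-visible if there is a shortest $x,y$-path in $G$ with no internal vertex in $X$; $X$ is a total mutual-visibility set if any two vertices of $V(G)$ are $X$-visible, and $\mu_{\rm t}(G)$ is the maximum cardinality of such a set. -}

module Defs where

open import Data.Nat using (ℕ; zero; suc; _≤_)
open import Data.Fin using (Fin)
open import Data.Fin.Subset using (Subset; _∈_; _∉_; ∣_∣)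
open import Data.Bool using (Bool; true; false; T)
open import Data.Unit using (⊤)
open import Data.Product using (Σ; ∃; _×_; _,_)
open import Relation.Binary.PropositionalEquality using (_≡_; _≢_)
open import Function.Bundles using (_⇔_)

record Graph : Set where
  field
    n     : ℕ
    adj   : Fin n → Fin n → Bool
    sym   : ∀ x y → adj x y ≡ adj y x
    loopless : ∀ x → adj x x ≡ false

open Graph public

Adj : (G : Graph) → Fin (n G) → Fin (n G) → Set
Adj G x y = T (adj G x y)

data Walk (G : Graph) : Fin (n G) → Fin (n G) → ℕ → Set where
  []  : ∀ {x} → Walk G x x 0
  _∷_ : ∀ {x y z k} → Adj G x y → Walk G y z k → Walk G x z (suc k)

-- a shortest x,y-path: a walk of minimum length (such walks are paths)
IsShortest : (G : Graph) {x y : Fin (n G)} {k : ℕ} → Walk G x y k → Set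
IsShortest G {x} {y} {k} _ = ∀ k′ → Walk G x y k′ → k ≤ k′

Connected : Graph → Set
Connected G = ∀ x y → ∃ λ k → Walk G x y k

-- geodetic: connected, and any two shortest x,y-paths coincide
-- (shortest x,y-paths all have the same length)
Geodetic : Graph → Set
Geodetic G = Connected G ×
  (∀ {x y k} (p q : Walk G x y k) → IsShortest G p → IsShortest G q → p ≡ q)

Simplicial : (G : Graph) → Fin (n G) → Set
Simplicial G v = ∀ u w → Adj G v u → Adj G v w → u ≢ w → Adj G u w

IsSimplicialSet : (G : Graph) → Subset (n G) → Set
IsSimplicialSet G S = ∀ v → (v ∈ S) ⇔ Simplicial G v

-- no internal vertex of the walk lies in X
-- (interior: all vertices except the first and the last)
NoInnerIn' : {G : Graph} (X : Subset (n G)) {x y : Fin (n G)} {k : ℕ} → Walk G x y k → Set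
NoInnerIn' X [] = ⊤
NoInnerIn' X (_∷_ {x} _ w) = (x ∉ X) × NoInnerIn' X w

NoInnerIn : {G : Graph} (X : Subset (n G)) {x y : Fin (n G)} {k : ℕ} → Walk G x y k → Set
NoInnerIn X [] = ⊤
NoInnerIn X (_ ∷ w) = NoInnerIn' X w

Visible : (G : Graph) → Subset (n G) → Fin (n G) → Fin (n G) → Set
Visible G X x y = ∃ λ k → Σ (Walk G x y k) λ p → IsShortest G p × NoInnerIn X p

IsTotalMutualVisibilitySet : (G : Graph) → Subset (n G) → Set
IsTotalMutualVisibilitySet G X = ∀ x y → Visible G X x y

IsMuT : Graph → ℕ → Set
IsMuT G m = (∃ λ X → IsTotalMutualVisibilitySet G X × ∣ X ∣ ≡ m)
          × (∀ X → IsTotalMutualVisibilitySet G X → ∣ X ∣ ≤ m)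

-- A simplicial vertex v is never interior to a shortest path: its two
-- path-neighbours are equal or adjacent, so the path could be shortened.
-- Hence S(G) is a total mutual-visibility set in every connected graph.
-- Conversely, if v lies in a total mutual-visibility set X of a geodetic
-- graph and u, w are distinct non-adjacent neighbours of v, then u v w is
-- the unique shortest u,w-path, so u and w are not X-visible.  Thus every
-- such X is contained in S(G), which gives both the bound and uniqueness.
module Submission where

open import Defs
open import Data.Fin.Subset using (Subset; ∣_∣)
open import Data.Product using (_×_)
open import Relation.Binary.PropositionalEquality using (_≡_)

open import Data.Bool using (T; T?)
open import Data.Empty using (⊥-elim)
open import Data.Fin using (_≟_)
open import Data.Fin.Properties using (any?)
open import Data.Fin.Subset using (_∈_; _⊆_)
open import Data.Fin.Subset.Properties
  using (_∈?_; ⊆-antisym; p⊆q⇒∣p∣≤∣q∣; p⊂q⇒∣p∣<∣q∣)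
open import Data.Nat using (ℕ; zero; suc; _≤_; _<_; z≤n; s≤s; s≤s⁻¹)
open import Data.Nat.Induction using (<-rec)
open import Data.Nat.Properties using (anyUpTo?; ≮⇒≥; <⇒≢; <⇒≤; 1+n≰n)
open import Data.Product using (Σ; ∃; _,_; proj₁; proj₂)
open import Function.Bundles using (Equivalence)
open import Level using (Level)
open import Relation.Binary.PropositionalEquality using (refl; subst; _≢_)
open import Relation.Nullary using (Dec; yes; no; ¬_)
open import Relation.Nullary.Decidable using (map′; _×-dec_)
open import Relation.Unary using (Pred; Decidable)

least-witness : ∀ {p : Level} {P : Pred ℕ p} → Decidable P →
                ∀ {k} → P k → ∃ λ m → P m × (∀ j → P j → m ≤ j)
least-witness {P = P} P? {k} = <-rec Least search k
  where
  Least : ℕ → Set _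
  Least k = P k → ∃ λ m → P m × (∀ j → P j → m ≤ j)

  search : ∀ k → (∀ {j} → j < k → Least j) → Least k
  search k below Pk with anyUpTo? P? k
  ... | yes (j , j<k , Pj) = below j<k Pj
  ... | no ∄j = k , Pk , λ j Pj → ≮⇒≥ (λ j<k → ∄j (j , j<k , Pj))

p⊆q∧∣p∣≡∣q∣⇒p≡q : ∀ {m} {p q : Subset m} → p ⊆ q → ∣ p ∣ ≡ ∣ q ∣ → p ≡ q
p⊆q∧∣p∣≡∣q∣⇒p≡q {p = p} p⊆q ∣p∣≡∣q∣ = ⊆-antisym p⊆q q⊆p
  where
  q⊆p : _ ⊆ p
  q⊆p {x} x∈q with x ∈? p
  ... | yes x∈p = x∈p
  ... | no x∉p = ⊥-elim (<⇒≢ (p⊂q⇒∣p∣<∣q∣ (p⊆q , x , x∈q , x∉p)) ∣p∣≡∣q∣)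

module _ (G : Graph) where

  Adj-sym : ∀ {x y} → Adj G x y → Adj G y x
  Adj-sym {x} {y} = subst T (sym G x y)

  walk? : ∀ k x y → Dec (Walk G x y k)
  walk? zero x y = map′ (λ { refl → [] }) (λ { [] → refl }) (x ≟ y)
  walk? (suc k) x y =
    map′ (λ { (z , xz , w) → xz ∷ w }) (λ { (xz ∷ w) → _ , xz , w })
         (any? λ z → T? (adj G x z) ×-dec walk? k z y)

  shortest-walk : ∀ {x y k} → Walk G x y k → ∃ λ m → Σ (Walk G x y m) (IsShortest G)
  shortest-walk {x} {y} = least-witness (λ k → walk? k x y)

  IsShortest-∷⁻ : ∀ {x v y k} (xv : Adj G x v) (r : Walk G v y k) →
                  IsShortest G (xv ∷ r) → IsShortest G r
  IsShortest-∷⁻ xv r shortest k′ r′ = s≤s⁻¹ (shortest (suc k′) (xv ∷ r′))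

  simplicial⇒¬interior : ∀ {x v z y k} → Simplicial G v →
    (xv : Adj G x v) (vz : Adj G v z) (r : Walk G z y k) → ¬ IsShortest G (xv ∷ (vz ∷ r))
  simplicial⇒¬interior {x} {z = z} {k = k} simplicial xv vz r shortest with x ≟ z
  ... | yes refl = 1+n≰n (<⇒≤ (shortest k r))
  ... | no x≢z   = 1+n≰n (s≤s⁻¹ (shortest (suc k) (xz ∷ r)))
    where
    xz : Adj G x z
    xz = simplicial x z (Adj-sym xv) vz x≢z

  module _ {X : Subset (n G)} (X-simplicial : ∀ {v} → v ∈ X → Simplicial G v) where

    shortest⇒NoInnerIn' : ∀ {x v y k} (xv : Adj G x v) (r : Walk G v y k) →
                          IsShortest G (xv ∷ r) → NoInnerIn' X r
    shortest⇒NoInnerIn' xv [] _ = _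
    shortest⇒NoInnerIn' xv (vz ∷ r) shortest =
      (λ v∈X → simplicial⇒¬interior (X-simplicial v∈X) xv vz r shortest) ,
      shortest⇒NoInnerIn' vz r (IsShortest-∷⁻ xv (vz ∷ r) shortest)

    shortest⇒NoInnerIn : ∀ {x y k} (p : Walk G x y k) → IsShortest G p → NoInnerIn X p
    shortest⇒NoInnerIn [] _ = _
    shortest⇒NoInnerIn (xv ∷ r) = shortest⇒NoInnerIn' xv r

    simplicial⇒totalMutualVisibility : Connected G → IsTotalMutualVisibilitySet G X
    simplicial⇒totalMutualVisibility connected x y
      with m , p , shortest ← shortest-walk (proj₂ (connected x y))
      = m , p , shortest , shortest⇒NoInnerIn p shortest

  module _ (geodetic : Geodetic G) {X : Subset (n G)} where

    detour-shortest : ∀ {u v w} → u ≢ w → ¬ Adj G u w →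
      (uv : Adj G u v) (vw : Adj G v w) → IsShortest G (uv ∷ (vw ∷ []))
    detour-shortest u≢w ¬uw uv vw _ []             = ⊥-elim (u≢w refl)
    detour-shortest u≢w ¬uw uv vw _ (uw ∷ [])      = ⊥-elim (¬uw uw)
    detour-shortest u≢w ¬uw uv vw _ (_ ∷ (_ ∷ _))    = s≤s (s≤s z≤n)

    detour-hidden : ∀ {u v w} → u ≢ w → ¬ Adj G u w →
      Adj G u v → Adj G v w → v ∈ X → ¬ Visible G X u w
    detour-hidden u≢w ¬uw uv vw v∈X (_ , [] , _) = u≢w refl
    detour-hidden u≢w ¬uw uv vw v∈X (_ , uw ∷ [] , _) = ¬uw uw
    detour-hidden u≢w ¬uw uv vw v∈X (_ , p@(_ ∷ (_ ∷ [])) , shortest , noInner) =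
      proj₁ (subst (NoInnerIn X) p≡uvw noInner) v∈X
      where
      p≡uvw : p ≡ uv ∷ (vw ∷ [])
      p≡uvw = proj₂ geodetic p (uv ∷ (vw ∷ [])) shortest (detour-shortest u≢w ¬uw uv vw)
    detour-hidden u≢w ¬uw uv vw v∈X (_ , _ ∷ (_ ∷ (_ ∷ _)) , shortest , _)
      with shortest 2 (uv ∷ (vw ∷ []))
    ... | s≤s (s≤s ())

    totalMutualVisibility⇒simplicial : IsTotalMutualVisibilitySet G X →
                                       ∀ {v} → v ∈ X → Simplicial G v
    totalMutualVisibility⇒simplicial visible v∈X u w vu vw u≢w with T? (adj G u w)
    ... | yes uw = uw
    ... | no ¬uw = ⊥-elim (detour-hidden u≢w ¬uw (Adj-sym vu) vw v∈X (visible u w))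

proposition5p1 : (G : Graph) → Geodetic G → (S : Subset (n G)) → IsSimplicialSet G S →
    IsMuT G ∣ S ∣ ×
    (IsTotalMutualVisibilitySet G S ×
    (∀ X → IsTotalMutualVisibilitySet G X → ∣ X ∣ ≡ ∣ S ∣ → X ≡ S))
proposition5p1 G geodetic S isS =
  ((S , S-visible , refl) , λ X visible → p⊆q⇒∣p∣≤∣q∣ (⊆S visible)) ,
  S-visible ,
  λ X visible ∣X∣≡∣S∣ → p⊆q∧∣p∣≡∣q∣⇒p≡q (⊆S visible) ∣X∣≡∣S∣
  where
  S-visible : IsTotalMutualVisibilitySet G S
  S-visible = simplicial⇒totalMutualVisibility G (Equivalence.to (isS _)) (proj₁ geodetic)

  ⊆S : ∀ {X} → IsTotalMutualVisibilitySet G X → X ⊆ S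
  ⊆S visible v∈X = Equivalence.from (isS _) (totalMutualVisibility⇒simplicial G geodetic visible v∈X)
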